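{- Let $R$ be a commutative ring with unity, let $k\geq 1$ be an integer, and let $\mathcal{I}\subseteq R$ be an ideal satisfying the unital set condition. Then the reduction map $SL_k(R)\to SL_k(R/\mathcal{I})$ is surjective, where $SL_k(S)=\{A\in M_k(S)\mid \det(A)=1\}$.
   Context: A finite list $a_1,\dots,a_k$ of elements of $R$ (repetitions allowed) is called a unital set if the ideal $(a_1,\dots,a_k)$ equals $R$. An ideal $\mathcal{I}\subseteq R$ satisfies the unital set condition (USC) if for every unital set $\{a_1,\dots,a_k\}\subseteq R$ with $k\ge 2$ there exists $j\in(a_2,\dots,a_k)$ such that $a_1+j$ is a unit modulo $\mathcal{I}$. -}

module Defs where

open import Level using (Level; _⊔_) renaming (suc to lsuc)
open import Data.Nat using (ℕ; zero) renaming (suc to sucℕ)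
open import Data.Fin using (Fin; zero; suc; punchIn)
open import Data.Product using (Σ; ∃; _×_; _,_; proj₁; proj₂)
open import Function using (_∘_)
import Relation.Binary.PropositionalEquality as P
open P using (_≡_)
open import Algebra.Bundles using (CommutativeRing; Ring)
open import Algebra.Structures using (IsCommutativeRing)
open import Relation.Binary.Structures using (IsEquivalence)
import Relation.Binary.Reasoning.Setoid as SetoidReasoning

module _ {c ℓ : Level} (S : CommutativeRing c ℓ) where
  open CommutativeRing S hiding (zero)

  sumF : (n : ℕ) → (Fin n → Carrier) → Carrier
  sumF zero    f = 0#
  sumF (sucℕ n) f = f zero + sumF n (f ∘ suc)

  Matrix : ℕ → Set c
  Matrix k = Fin k → Fin k → Carrier

  signF : {n : ℕ} → Fin n → Carrier
  signF zero    = 1#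
  signF (suc j) = - signF j

  det : (k : ℕ) → Matrix k → Carrier
  det zero     M = 1#
  det (sucℕ n) M =
    sumF (sucℕ n) (λ j → signF j * (M zero j * det n (λ r s → M (suc r) (punchIn j s))))

  SL : ℕ → Set (c ⊔ ℓ)
  SL k = Σ (Matrix k) (λ A → det k A ≈ 1#)

  _∈⟨_⟩ : Carrier → {n : ℕ} → (Fin n → Carrier) → Set (c ⊔ ℓ)
  _∈⟨_⟩ x {n} a = ∃ λ (r : Fin n → Carrier) → x ≈ sumF n (λ i → r i * a i)

  Unital : {n : ℕ} → (Fin n → Carrier) → Set (c ⊔ ℓ)
  Unital a = 1# ∈⟨ a ⟩

module _ {c ℓ : Level} (R : CommutativeRing c ℓ) where
  open CommutativeRing R hiding (zero)

  record Ideal (ℓI : Level) : Set (c ⊔ ℓ ⊔ lsuc ℓI) where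
    field
      _∈I       : Carrier → Set ℓI
      ∈-resp-≈  : ∀ {x y} → x ≈ y → x ∈I → y ∈I
      0∈        : 0# ∈I
      +-closed  : ∀ {x y} → x ∈I → y ∈I → (x + y) ∈I
      *-closed  : ∀ r {x} → x ∈I → (r * x) ∈I

module Quotient {c ℓ ℓI : Level} (R : CommutativeRing c ℓ) (I : Ideal R ℓI) where
  open CommutativeRing R hiding (zero)
  open Ideal I
  open import Algebra.Properties.Ring ring using (-1*x≈-x)
  open import Algebra.Properties.RingWithoutOne (Ring.ringWithoutOne ring) using (x[y-z]≈xy-xz)
  open import Algebra.Properties.AbelianGroup +-abelianGroup using (⁻¹-anti-homo‿-; ⁻¹-∙-comm)
  open import Algebra.Properties.CommutativeSemigroup +-commutativeSemigroup using (interchange)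
  open SetoidReasoning setoid

  telescope : ∀ x y z → (x - y) + (y - z) ≈ x - z
  telescope x y z = begin
    (x - y) + (y - z)     ≈⟨ +-assoc x (- y) (y - z) ⟩
    x + (- y + (y - z))   ≈⟨ +-congˡ (sym (+-assoc (- y) y (- z))) ⟩
    x + ((- y + y) - z)   ≈⟨ +-congˡ (+-congʳ (-‿inverseˡ y)) ⟩
    x + (0# - z)          ≈⟨ +-congˡ (+-identityˡ (- z)) ⟩
    x - z                 ∎

  plusLemma : ∀ x y u v → (x - y) + (u - v) ≈ (x + u) - (y + v)
  plusLemma x y u v = begin
    (x - y) + (u - v)     ≈⟨ interchange x (- y) u (- v) ⟩
    (x + u) + (- y - v)   ≈⟨ +-congˡ (⁻¹-∙-comm y v) ⟩
    (x + u) - (y + v)     ∎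

  timesLemma : ∀ x y u v → (u * (x - y)) + (y * (u - v)) ≈ (x * u) - (y * v)
  timesLemma x y u v = begin
    (u * (x - y)) + (y * (u - v))       ≈⟨ +-cong (x[y-z]≈xy-xz u x y) (x[y-z]≈xy-xz y u v) ⟩
    (u * x - u * y) + (y * u - y * v)   ≈⟨ +-congʳ (+-cong (*-comm u x) (-‿cong (*-comm u y))) ⟩
    (x * u - y * u) + (y * u - y * v)   ≈⟨ telescope (x * u) (y * u) (y * v) ⟩
    (x * u) - (y * v)                   ∎

  _~_ : Carrier → Carrier → Set ℓI
  x ~ y = (x - y) ∈I

  neg-closed : ∀ {x} → x ∈I → (- x) ∈I
  neg-closed {x} p = ∈-resp-≈ (-1*x≈-x x) (*-closed (- 1#) p)

  lift : ∀ {x y} → x ≈ y → x ~ y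
  lift {x} {y} p = ∈-resp-≈ (sym (trans (+-congʳ p) (-‿inverseʳ y))) 0∈

  ~-isEquivalence : IsEquivalence _~_
  ~-isEquivalence = record
    { refl  = lift refl
    ; sym   = λ {x} {y} p → ∈-resp-≈ (⁻¹-anti-homo‿- x y) (neg-closed p)
    ; trans = λ {x} {y} {z} p q → ∈-resp-≈ (telescope x y z) (+-closed p q)
    }

  quotientRing : CommutativeRing c ℓI
  quotientRing = record
    { Carrier = Carrier ; _≈_ = _~_ ; _+_ = _+_ ; _*_ = _*_ ; -_ = -_ ; 0# = 0# ; 1# = 1#
    ; isCommutativeRing = record
      { isRing = record
        { +-isAbelianGroup = record
          { isGroup = record
            { isMonoid = record
              { isSemigroup = record
                { isMagma = record
                  { isEquivalence = ~-isEquivalence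
                  ; ∙-cong = λ {x} {y} {u} {v} p q → ∈-resp-≈ (plusLemma x y u v) (+-closed p q)
                  }
                ; assoc = λ x y z → lift (+-assoc x y z)
                }
              ; identity = (λ x → lift (+-identityˡ x)) , (λ x → lift (+-identityʳ x))
              }
            ; inverse = (λ x → lift (-‿inverseˡ x)) , (λ x → lift (-‿inverseʳ x))
            ; ⁻¹-cong = λ {x} {y} p → ∈-resp-≈ (sym (⁻¹-∙-comm x (- y))) (neg-closed p)
            }
          ; comm = λ x y → lift (+-comm x y)
          }
        ; *-cong = λ {x} {y} {u} {v} p q → ∈-resp-≈ (timesLemma x y u v) (+-closed (*-closed u p) (*-closed y q))
        ; *-assoc = λ x y z → lift (*-assoc x y z)
        ; *-identity = (λ x → lift (*-identityˡ x)) , (λ x → lift (*-identityʳ x))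
        ; distrib = (λ x y z → lift (distribˡ x y z)) , (λ x y z → lift (distribʳ x y z))
        }
      ; *-comm = λ x y → lift (*-comm x y)
      }
    }

  IsUnitMod : Carrier → Set (c ⊔ ℓI)
  IsUnitMod x = ∃ λ u → (x * u) ~ 1#

  sumF-≡ : ∀ n (f g : Fin n → Carrier) → (∀ j → f j ≡ g j) → sumF quotientRing n f ≡ sumF R n g
  sumF-≡ zero     f g e = P.refl
  sumF-≡ (sucℕ n) f g e = P.cong₂ _+_ (e zero) (sumF-≡ n (f ∘ suc) (g ∘ suc) (e ∘ suc))

  signF-≡ : ∀ {n} (j : Fin n) → signF quotientRing j ≡ signF R j
  signF-≡ zero    = P.refl
  signF-≡ (suc j) = P.cong -_ (signF-≡ j)

  det-≡ : ∀ k M → det quotientRing k M ≡ det R k M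
  det-≡ zero     M = P.refl
  det-≡ (sucℕ n) M = sumF-≡ (sucℕ n) _ _
    (λ j → P.cong₂ (λ a b → a * (M zero j * b)) (signF-≡ j) (det-≡ n (λ r s → M (suc r) (punchIn j s))))

  reduce : (k : ℕ) → SL R k → SL quotientRing k
  reduce k (A , p) = A , P.subst (λ d → d ~ 1#) (P.sym (det-≡ k A)) (lift p)

  _≈SL_ : {k : ℕ} → SL quotientRing k → SL quotientRing k → Set ℓI
  _≈SL_ {k} A B = ∀ i j → proj₁ A i j ~ proj₁ B i j

-- The unital set condition (USC) for an ideal I of R:
-- for every unital set a_1,…,a_n (n ≥ 2, written n = m + 2) there is
-- j ∈ (a_2,…,a_n) with a_1 + j a unit modulo I.
USC : {c ℓ ℓI : Level} (R : CommutativeRing c ℓ) → Ideal R ℓI → Set (c ⊔ ℓ ⊔ ℓI)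
USC R I = ∀ (m : ℕ) (a : Fin (sucℕ (sucℕ m)) → Carrier) → Unital R a →
            ∃ λ j → (_∈⟨_⟩ R j (a ∘ suc)) × IsUnitMod (a zero + j)
  where
    open CommutativeRing R hiding (zero)
    open Quotient R I

-- If det B ≡ 1 mod I, cofactor expansion along the first row
-- shows that the first row of B together with det B − 1 is a unital set, so the
-- USC provides a combination of the other first-row entries which, added to the
-- corner entry, makes it a unit modulo I. Column operations adding a multiple of
-- one column to another are invertible and preserve det over R; with them the
-- first row becomes (1, 0, …, 0) modulo I. The lower-right minor then has
-- determinant ≡ 1 and lifts by induction; bordering its lift and undoing the
-- column operations lifts B.

module Submission where

open import Defs
open import Level using (Level; _⊔_)
open import Data.Nat using (ℕ; _≤_; zero; suc; pred)
open import Data.Product using (∃; _,_; proj₁; proj₂; _×_)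
open import Algebra.Bundles using (CommutativeRing; Ring)
open import Algebra.Core using (Op₁; Op₂)
open import Data.Empty using (⊥-elim)
open import Data.Fin using (Fin; zero; suc; punchIn; punchOut; inject₁; toℕ)
open import Data.Fin.Properties using (punchIn-injective; punchInᵢ≢i; punchIn-punchOut; toℕ-inject₁)
open import Data.Sum using (_⊎_; inj₁; inj₂)
open import Data.List using (List; []; _∷_; _++_; tabulate)
open import Data.Vec.Functional using () renaming (_∷_ to _◃_)
open import Function using (_∘_; id)
import Relation.Binary.PropositionalEquality as P
open P using (_≡_; _≢_)
import Relation.Binary.Reasoning.Setoid as SetoidReasoning

punchIn-inject₁-self : ∀ {n} (a : Fin n) → punchIn (inject₁ a) a ≡ suc a
punchIn-inject₁-self zero    = P.refl
punchIn-inject₁-self (suc a) = P.cong suc (punchIn-inject₁-self a)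

punchIn-suc-self : ∀ {n} (a : Fin n) → punchIn (suc a) a ≡ inject₁ a
punchIn-suc-self zero    = P.refl
punchIn-suc-self (suc a) = P.cong suc (punchIn-suc-self a)

punchIn-inject₁≡punchIn-suc⊎≡ : ∀ {n} (a x : Fin n) →
                                (punchIn (inject₁ a) x ≡ punchIn (suc a) x) ⊎ (x ≡ a)
punchIn-inject₁≡punchIn-suc⊎≡ zero    zero    = inj₂ P.refl
punchIn-inject₁≡punchIn-suc⊎≡ zero    (suc x) = inj₁ P.refl
punchIn-inject₁≡punchIn-suc⊎≡ (suc a) zero    = inj₁ P.refl
punchIn-inject₁≡punchIn-suc⊎≡ (suc a) (suc x) with punchIn-inject₁≡punchIn-suc⊎≡ a x
... | inj₁ e = inj₁ (P.cong suc e)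
... | inj₂ e = inj₂ (P.cong suc e)

avoidPair : ∀ {m} → Fin (suc m) → Fin m → Fin (suc (suc m))
avoidPair a s = punchIn (inject₁ a) (punchIn a s)

pairIndex : ∀ {m} → Fin (suc m) → Fin m → Fin m
pairIndex zero    zero    = zero
pairIndex zero    (suc s) = zero
pairIndex (suc a) zero    = a
pairIndex (suc a) (suc s) = suc (pairIndex a s)

punchIn-avoidPair-inject₁ : ∀ {m} (a : Fin (suc m)) (s : Fin m) →
                            punchIn (avoidPair a s) (inject₁ (pairIndex a s)) ≡ inject₁ a
punchIn-avoidPair-inject₁ zero    zero    = P.refl
punchIn-avoidPair-inject₁ zero    (suc s) = P.refl
punchIn-avoidPair-inject₁ (suc a) zero    = P.refl
punchIn-avoidPair-inject₁ (suc a) (suc s) = P.cong suc (punchIn-avoidPair-inject₁ a s)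

punchIn-avoidPair-suc : ∀ {m} (a : Fin (suc m)) (s : Fin m) →
                        punchIn (avoidPair a s) (suc (pairIndex a s)) ≡ suc a
punchIn-avoidPair-suc zero    zero    = P.refl
punchIn-avoidPair-suc zero    (suc s) = P.refl
punchIn-avoidPair-suc (suc a) zero    = P.refl
punchIn-avoidPair-suc (suc a) (suc s) = P.cong suc (punchIn-avoidPair-suc a s)

swapAdjacent : ∀ {n} → Fin n → Fin (suc n) → Fin (suc n)
swapAdjacent zero    zero          = suc zero
swapAdjacent zero    (suc zero)    = zero
swapAdjacent zero    (suc (suc x)) = suc (suc x)
swapAdjacent (suc a) zero          = zero
swapAdjacent (suc a) (suc x)       = suc (swapAdjacent a x)

swapAdjacent-inject₁ : ∀ {n} (a : Fin n) → swapAdjacent a (inject₁ a) ≡ suc a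
swapAdjacent-inject₁ zero    = P.refl
swapAdjacent-inject₁ (suc a) = P.cong suc (swapAdjacent-inject₁ a)

swapAdjacent-suc : ∀ {n} (a : Fin n) → swapAdjacent a (suc a) ≡ inject₁ a
swapAdjacent-suc zero    = P.refl
swapAdjacent-suc (suc a) = P.cong suc (swapAdjacent-suc a)

swapAdjacent-punchIn-inject₁ : ∀ {n} (a x : Fin n) →
                               swapAdjacent a (punchIn (inject₁ a) x) ≡ punchIn (suc a) x
swapAdjacent-punchIn-inject₁ zero    zero    = P.refl
swapAdjacent-punchIn-inject₁ zero    (suc x) = P.refl
swapAdjacent-punchIn-inject₁ (suc a) zero    = P.refl
swapAdjacent-punchIn-inject₁ (suc a) (suc x) = P.cong suc (swapAdjacent-punchIn-inject₁ a x)

swapAdjacent-punchIn-suc : ∀ {n} (a x : Fin n) →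
                           swapAdjacent a (punchIn (suc a) x) ≡ punchIn (inject₁ a) x
swapAdjacent-punchIn-suc zero    zero    = P.refl
swapAdjacent-punchIn-suc zero    (suc x) = P.refl
swapAdjacent-punchIn-suc (suc a) zero    = P.refl
swapAdjacent-punchIn-suc (suc a) (suc x) = P.cong suc (swapAdjacent-punchIn-suc a x)

swapAdjacent-avoidPair : ∀ {m} (a : Fin (suc m)) (s : Fin m) →
                         swapAdjacent a (avoidPair a s) ≡ avoidPair a s
swapAdjacent-avoidPair zero    zero    = P.refl
swapAdjacent-avoidPair zero    (suc s) = P.refl
swapAdjacent-avoidPair (suc a) zero    = P.refl
swapAdjacent-avoidPair (suc a) (suc s) = P.cong suc (swapAdjacent-avoidPair a s)

swapAdjacent-punchIn-avoidPair : ∀ {m} (a : Fin (suc m)) (s : Fin m) (x : Fin (suc m)) →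
  swapAdjacent a (punchIn (avoidPair a s) x) ≡ punchIn (avoidPair a s) (swapAdjacent (pairIndex a s) x)
swapAdjacent-punchIn-avoidPair zero    zero    zero          = P.refl
swapAdjacent-punchIn-avoidPair zero    zero    (suc zero)    = P.refl
swapAdjacent-punchIn-avoidPair zero    zero    (suc (suc x)) = P.refl
swapAdjacent-punchIn-avoidPair zero    (suc s) zero          = P.refl
swapAdjacent-punchIn-avoidPair zero    (suc s) (suc zero)    = P.refl
swapAdjacent-punchIn-avoidPair zero    (suc s) (suc (suc x)) = P.refl
swapAdjacent-punchIn-avoidPair (suc a) zero    zero          = P.refl
swapAdjacent-punchIn-avoidPair (suc a) zero    (suc x)       = P.refl
swapAdjacent-punchIn-avoidPair (suc a) (suc s) zero          = P.refl
swapAdjacent-punchIn-avoidPair (suc a) (suc s) (suc x)       = P.cong suc (swapAdjacent-punchIn-avoidPair a s x)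

data ColumnOp {c} (C : Set c) (n : ℕ) : Set c where
  addToFirst : Fin n → C → ColumnOp C n
  addFirstTo : Fin n → C → ColumnOp C n

-- Parametrised by the bare operations (not a ring) so that a ring and its
-- quotient, which share them, share the column operations definitionally.
module ColumnOperations {c} {C : Set c} (_+_ _*_ : Op₂ C) (-_ : Op₁ C) (0# 1# : C) where

  δ : ∀ {n} → Fin n → Fin n → C
  δ zero    zero    = 1#
  δ zero    (suc _) = 0#
  δ (suc _) zero    = 0#
  δ (suc a) (suc b) = δ a b

  applyColumnOp : ∀ {n} → ColumnOp C n → (Fin (suc n) → Fin (suc n) → C) → Fin (suc n) → Fin (suc n) → C
  applyColumnOp (addToFirst l r) M i zero    = M i zero + (r * M i (suc l))
  applyColumnOp (addToFirst l r) M i (suc j) = M i (suc j)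
  applyColumnOp (addFirstTo l r) M i zero    = M i zero
  applyColumnOp (addFirstTo l r) M i (suc j) = M i (suc j) + (δ l j * (r * M i zero))

  applyColumnOps : ∀ {n} → List (ColumnOp C n) → (Fin (suc n) → Fin (suc n) → C) → Fin (suc n) → Fin (suc n) → C
  applyColumnOps []       M = M
  applyColumnOps (o ∷ os) M = applyColumnOps os (applyColumnOp o M)

  applyColumnOps-++ : ∀ {n} (os os′ : List (ColumnOp C n)) M →
                      applyColumnOps (os ++ os′) M ≡ applyColumnOps os′ (applyColumnOps os M)
  applyColumnOps-++ []       os′ M = P.refl
  applyColumnOps-++ (o ∷ os) os′ M = applyColumnOps-++ os os′ (applyColumnOp o M)

  inverseColumnOp : ∀ {n} → ColumnOp C n → ColumnOp C n
  inverseColumnOp (addToFirst l r) = addToFirst l (- r)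
  inverseColumnOp (addFirstTo l r) = addFirstTo l (- r)

module Determinants {c ℓ : Level} (S : CommutativeRing c ℓ) where
  open CommutativeRing S hiding (zero)
  open ColumnOperations _+_ _*_ -_ 0# 1# public
  open SetoidReasoning setoid
  open import Algebra.Properties.RingWithoutOne (Ring.ringWithoutOne ring) using (-‿distribˡ-*; -‿distribʳ-*)
  open import Algebra.Properties.AbelianGroup +-abelianGroup using (⁻¹-∙-comm)
  open import Algebra.Properties.Group +-group using (⁻¹-involutive; ε⁻¹≈ε)
  open import Algebra.Properties.CommutativeSemigroup +-commutativeSemigroup using (interchange; x∙yz≈y∙xz)

  y≈0⇒x+y≈x : ∀ {x y} → y ≈ 0# → x + y ≈ x
  y≈0⇒x+y≈x {x} e = trans (+-congˡ e) (+-identityʳ x)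

  y≈0⇒y+x≈x : ∀ {x y} → y ≈ 0# → y + x ≈ x
  y≈0⇒y+x≈x {x} e = trans (+-congʳ e) (+-identityˡ x)

  x+[y-x]≈y : ∀ x y → x + (y - x) ≈ y
  x+[y-x]≈y x y = trans (+-comm x _) (trans (+-assoc y (- x) x) (y≈0⇒x+y≈x (-‿inverseˡ x)))

  xy+[-x]y≈0 : ∀ x y → x * y + (- x) * y ≈ 0#
  xy+[-x]y≈0 x y = trans (sym (distribʳ y x (- x))) (trans (*-congʳ (-‿inverseʳ x)) (zeroˡ y))

  sumF-cong : ∀ n {f g : Fin n → Carrier} → (∀ i → f i ≈ g i) → sumF S n f ≈ sumF S n g
  sumF-cong zero    e = refl
  sumF-cong (suc n) e = +-cong (e zero) (sumF-cong n (e ∘ suc))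

  sumF-≈0 : ∀ n {f : Fin n → Carrier} → (∀ i → f i ≈ 0#) → sumF S n f ≈ 0#
  sumF-≈0 zero    e = refl
  sumF-≈0 (suc n) e = trans (+-cong (e zero) (sumF-≈0 n (e ∘ suc))) (+-identityˡ 0#)

  sumF-+ : ∀ n (f g : Fin n → Carrier) → sumF S n (λ i → f i + g i) ≈ sumF S n f + sumF S n g
  sumF-+ zero    f g = sym (+-identityˡ 0#)
  sumF-+ (suc n) f g = trans (+-congˡ (sumF-+ n (f ∘ suc) (g ∘ suc))) (interchange _ _ _ _)

  sumF-*ˡ : ∀ n r (f : Fin n → Carrier) → sumF S n (λ i → r * f i) ≈ r * sumF S n f
  sumF-*ˡ zero    r f = sym (zeroʳ r)
  sumF-*ˡ (suc n) r f = trans (+-congˡ (sumF-*ˡ n r (f ∘ suc))) (sym (distribˡ r _ _))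

  sumF-neg : ∀ n (f : Fin n → Carrier) → sumF S n (λ i → - f i) ≈ - sumF S n f
  sumF-neg zero    f = sym ε⁻¹≈ε
  sumF-neg (suc n) f = trans (+-congˡ (sumF-neg n (f ∘ suc))) (⁻¹-∙-comm _ _)

  sumF-punchIn : ∀ n (i : Fin (suc n)) (f : Fin (suc n) → Carrier) →
                 sumF S (suc n) f ≈ f i + sumF S n (f ∘ punchIn i)
  sumF-punchIn n       zero    f = refl
  sumF-punchIn (suc n) (suc i) f = trans (+-congˡ (sumF-punchIn n i (f ∘ suc))) (x∙yz≈y∙xz _ _ _)

  sumF-adjacentPair : ∀ m (a : Fin (suc m)) (f : Fin (suc (suc m)) → Carrier) →
    sumF S (suc (suc m)) f ≈ f (inject₁ a) + (f (suc a) + sumF S m (f ∘ avoidPair a))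
  sumF-adjacentPair m a f = trans (sumF-punchIn (suc m) (inject₁ a) f)
    (+-congˡ (trans (sumF-punchIn m a (f ∘ punchIn (inject₁ a)))
                    (+-congʳ (reflexive (P.cong f (punchIn-inject₁-self a))))))

  δ-refl : ∀ {n} (l : Fin n) → δ l l ≈ 1#
  δ-refl zero    = refl
  δ-refl (suc l) = δ-refl l

  δ-≢ : ∀ {n} {l j : Fin n} → l ≢ j → δ l j ≈ 0#
  δ-≢ {l = zero}  {zero}  l≢j = ⊥-elim (l≢j P.refl)
  δ-≢ {l = zero}  {suc j} l≢j = refl
  δ-≢ {l = suc l} {zero}  l≢j = refl
  δ-≢ {l = suc l} {suc j} l≢j = δ-≢ (l≢j ∘ P.cong suc)

  sumF-δ : ∀ n (j : Fin n) (w : Fin n → Carrier) → sumF S n (λ k → δ k j * w k) ≈ w j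
  sumF-δ (suc n) zero    w = trans (+-cong (*-identityˡ (w zero)) (sumF-≈0 n (λ k → zeroˡ _))) (+-identityʳ _)
  sumF-δ (suc n) (suc j) w = trans (y≈0⇒y+x≈x (zeroˡ (w zero))) (sumF-δ n j (w ∘ suc))

  signF-inject₁ : ∀ {n} (p : Fin n) → signF S (inject₁ p) ≡ signF S p
  signF-inject₁ zero    = P.refl
  signF-inject₁ (suc p) = P.cong -_ (signF-inject₁ p)

  signF-inject₁-* : ∀ {n} (p : Fin n) x → signF S (inject₁ p) * x ≈ signF S p * x
  signF-inject₁-* p x = reflexive (P.cong (_* x) (signF-inject₁ p))

  minor : ∀ {n} → Matrix S (suc n) → Fin (suc n) → Matrix S n
  minor M j r s = M (suc r) (punchIn j s)

  cofactorTerm : ∀ {n} → Matrix S (suc n) → Fin (suc n) → Carrier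
  cofactorTerm {n} M j = signF S j * (M zero j * det S n (minor M j))

  det-cong : ∀ k {M N : Matrix S k} → (∀ i j → M i j ≈ N i j) → det S k M ≈ det S k N
  det-cong zero    e = refl
  det-cong (suc n) e = sumF-cong (suc n) (λ j →
    *-congˡ {signF S j} (*-cong (e zero j) (det-cong n (λ r s → e (suc r) (punchIn j s)))))

  private
    a[[x+ry]d]≈a[xd]+r[a[yd]] : ∀ a x y r d → a * ((x + r * y) * d) ≈ a * (x * d) + r * (a * (y * d))
    a[[x+ry]d]≈a[xd]+r[a[yd]] a x y r d = begin
      a * ((x + r * y) * d)             ≈⟨ *-congˡ (distribʳ d x (r * y)) ⟩
      a * (x * d + (r * y) * d)         ≈⟨ distribˡ a _ _ ⟩
      a * (x * d) + a * ((r * y) * d)   ≈⟨ +-congˡ (*-congˡ (*-assoc r y d)) ⟩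
      a * (x * d) + a * (r * (y * d))   ≈⟨ +-congˡ (sym (*-assoc a r _)) ⟩
      a * (x * d) + (a * r) * (y * d)   ≈⟨ +-congˡ (*-congʳ (*-comm a r)) ⟩
      a * (x * d) + (r * a) * (y * d)   ≈⟨ +-congˡ (*-assoc r a _) ⟩
      a * (x * d) + r * (a * (y * d))   ∎

    a[x[d+re]]≈a[xd]+r[a[xe]] : ∀ a x r d e → a * (x * (d + r * e)) ≈ a * (x * d) + r * (a * (x * e))
    a[x[d+re]]≈a[xd]+r[a[xe]] a x r d e = begin
      a * (x * (d + r * e))             ≈⟨ *-congˡ (*-comm x _) ⟩
      a * ((d + r * e) * x)             ≈⟨ a[[x+ry]d]≈a[xd]+r[a[yd]] a d e r x ⟩
      a * (d * x) + r * (a * (e * x))   ≈⟨ +-cong (*-congˡ (*-comm d x)) (*-congˡ (*-congˡ (*-comm e x))) ⟩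
      a * (x * d) + r * (a * (x * e))   ∎

  det-linear : ∀ n (col : Fin n) (M N L : Matrix S n) r →
    (∀ i → M i col ≈ N i col + r * L i col) →
    (∀ i j → j ≢ col → M i j ≈ N i j) → (∀ i j → j ≢ col → M i j ≈ L i j) →
    det S n M ≈ det S n N + r * det S n L
  det-linear (suc n) col M N L r onCol offColN offColL = begin
    sumF S (suc n) (cofactorTerm M)
      ≈⟨ sumF-punchIn n col (cofactorTerm M) ⟩
    cofactorTerm M col + sumF S n (cofactorTerm M ∘ punchIn col)
      ≈⟨ +-cong atCol (sumF-cong n offCol) ⟩
    (cofactorTerm N col + r * cofactorTerm L col)
      + sumF S n (λ s → cofactorTerm N (punchIn col s) + r * cofactorTerm L (punchIn col s))
      ≈⟨ +-congˡ (trans (sumF-+ n _ _) (+-congˡ (sumF-*ˡ n r _))) ⟩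
    (cofactorTerm N col + r * cofactorTerm L col)
      + (sumF S n (cofactorTerm N ∘ punchIn col) + r * sumF S n (cofactorTerm L ∘ punchIn col))
      ≈⟨ trans (interchange _ _ _ _) (+-congˡ (sym (distribˡ r _ _))) ⟩
    (cofactorTerm N col + sumF S n (cofactorTerm N ∘ punchIn col))
      + r * (cofactorTerm L col + sumF S n (cofactorTerm L ∘ punchIn col))
      ≈⟨ sym (+-cong (sumF-punchIn n col (cofactorTerm N)) (*-congˡ (sumF-punchIn n col (cofactorTerm L)))) ⟩
    sumF S (suc n) (cofactorTerm N) + r * sumF S (suc n) (cofactorTerm L) ∎
    where
    atCol : cofactorTerm M col ≈ cofactorTerm N col + r * cofactorTerm L col
    atCol = trans (*-congˡ (*-congʳ (onCol zero))) (trans (a[[x+ry]d]≈a[xd]+r[a[yd]] _ _ _ r _)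
      (+-cong (*-congˡ (*-congˡ (det-cong n (λ i s → offColN (suc i) _ (punchInᵢ≢i col s)))))
              (*-congˡ (*-congˡ (*-congˡ (det-cong n (λ i s → offColL (suc i) _ (punchInᵢ≢i col s))))))))
    offCol : ∀ s → cofactorTerm M (punchIn col s) ≈ cofactorTerm N (punchIn col s) + r * cofactorTerm L (punchIn col s)
    offCol s = trans (*-congˡ (*-congˡ (det-linear n col′ (minor M j) (minor N j) (minor L j) r onCol′ offColN′ offColL′)))
                     (trans (a[x[d+re]]≈a[xd]+r[a[xe]] _ _ r _ _)
                            (+-cong (*-congˡ (*-congʳ (offColN zero j j≢col)))
                                    (*-congˡ (*-congˡ (*-congʳ (offColL zero j j≢col))))))
      where
      j : Fin (suc n)
      j = punchIn col s
      j≢col : j ≢ col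
      j≢col = punchInᵢ≢i col s
      col′ : Fin n
      col′ = punchOut j≢col
      onCol′ : ∀ i → minor M j i col′ ≈ minor N j i col′ + r * minor L j i col′
      onCol′ i rewrite punchIn-punchOut j≢col = onCol (suc i)
      punchIn≢col : ∀ t → t ≢ col′ → punchIn j t ≢ col
      punchIn≢col t t≢col′ e = t≢col′ (punchIn-injective j t col′ (P.trans e (P.sym (punchIn-punchOut j≢col))))
      offColN′ : ∀ i t → t ≢ col′ → minor M j i t ≈ minor N j i t
      offColN′ i t t≢col′ = offColN (suc i) (punchIn j t) (punchIn≢col t t≢col′)
      offColL′ : ∀ i t → t ≢ col′ → minor M j i t ≈ minor L j i t
      offColL′ i t t≢col′ = offColL (suc i) (punchIn j t) (punchIn≢col t t≢col′)

  -- The two terms of the pair cancel by the sign flip; every other term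
  -- has a minor that still contains the pair of equal columns.
  det-equalAdjacentColumns : ∀ n (M : Matrix S (suc n)) (a : Fin n) →
    (∀ i → M i (inject₁ a) ≈ M i (suc a)) → det S (suc n) M ≈ 0#
  det-equalAdjacentColumns (suc m) M a eq =
    trans (sumF-adjacentPair m a (cofactorTerm M)) (trans (+-congˡ (y≈0⇒x+y≈x others≈0)) pair≈0)
    where
    minors≈ : ∀ r t → M (suc r) (punchIn (inject₁ a) t) ≈ M (suc r) (punchIn (suc a) t)
    minors≈ r t with punchIn-inject₁≡punchIn-suc⊎≡ a t
    ... | inj₁ e      = reflexive (P.cong (M (suc r)) e)
    ... | inj₂ P.refl = P.subst₂ (λ u v → M (suc r) u ≈ M (suc r) v)
                          (P.sym (punchIn-inject₁-self a)) (P.sym (punchIn-suc-self a)) (sym (eq (suc r)))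
    pair≈0 : cofactorTerm M (inject₁ a) + cofactorTerm M (suc a) ≈ 0#
    pair≈0 = trans (+-congʳ (trans (signF-inject₁-* a _)
                     (*-congˡ (*-cong (eq zero) (det-cong (suc m) minors≈)))))
                   (xy+[-x]y≈0 (signF S a) _)
    others≈0 : sumF S m (cofactorTerm M ∘ avoidPair a) ≈ 0#
    others≈0 = sumF-≈0 m (λ s →
      trans (*-congˡ (*-congˡ (det-equalAdjacentColumns m (minor M (avoidPair a s)) (pairIndex a s) (eq′ s))))
            (trans (*-congˡ (zeroʳ _)) (zeroʳ _)))
      where
      eq′ : ∀ s i → minor M (avoidPair a s) i (inject₁ (pairIndex a s)) ≈ minor M (avoidPair a s) i (suc (pairIndex a s))
      eq′ s i rewrite punchIn-avoidPair-inject₁ a s | punchIn-avoidPair-suc a s = eq (suc i)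

  det-swapAdjacentColumns : ∀ n (M : Matrix S (suc n)) (a : Fin n) →
    det S (suc n) (λ i j → M i (swapAdjacent a j)) ≈ - det S (suc n) M
  det-swapAdjacentColumns (suc m) M a = begin
    det S (suc (suc m)) M′
      ≈⟨ sumF-adjacentPair m a (cofactorTerm M′) ⟩
    cofactorTerm M′ (inject₁ a) + (cofactorTerm M′ (suc a) + sumF S m (cofactorTerm M′ ∘ avoidPair a))
      ≈⟨ +-cong atInject₁ (+-cong atSuc others) ⟩
    - cofactorTerm M (suc a) + (- cofactorTerm M (inject₁ a) + - sumF S m (cofactorTerm M ∘ avoidPair a))
      ≈⟨ x∙yz≈y∙xz _ _ _ ⟩
    - cofactorTerm M (inject₁ a) + (- cofactorTerm M (suc a) + - sumF S m (cofactorTerm M ∘ avoidPair a))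
      ≈⟨ trans (+-congˡ (⁻¹-∙-comm _ _)) (⁻¹-∙-comm _ _) ⟩
    - (cofactorTerm M (inject₁ a) + (cofactorTerm M (suc a) + sumF S m (cofactorTerm M ∘ avoidPair a)))
      ≈⟨ -‿cong (sym (sumF-adjacentPair m a (cofactorTerm M))) ⟩
    - det S (suc (suc m)) M ∎
    where
    M′ : Matrix S (suc (suc m))
    M′ i j = M i (swapAdjacent a j)
    atInject₁ : cofactorTerm M′ (inject₁ a) ≈ - cofactorTerm M (suc a)
    atInject₁ = trans (signF-inject₁-* a _)
      (trans (*-congˡ (*-cong (reflexive (P.cong (M zero) (swapAdjacent-inject₁ a)))
                              (det-cong (suc m) (λ r t → reflexive (P.cong (M (suc r)) (swapAdjacent-punchIn-inject₁ a t))))))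
             (trans (sym (⁻¹-involutive _)) (-‿cong (-‿distribˡ-* (signF S a) _))))
    atSuc : cofactorTerm M′ (suc a) ≈ - cofactorTerm M (inject₁ a)
    atSuc = trans (*-congˡ (*-cong (reflexive (P.cong (M zero) (swapAdjacent-suc a)))
                             (det-cong (suc m) (λ r t → reflexive (P.cong (M (suc r)) (swapAdjacent-punchIn-suc a t))))))
              (trans (sym (-‿distribˡ-* (signF S a) _)) (-‿cong (sym (signF-inject₁-* a _))))
    others : sumF S m (cofactorTerm M′ ∘ avoidPair a) ≈ - sumF S m (cofactorTerm M ∘ avoidPair a)
    others = trans (sumF-cong m atAvoid) (sumF-neg m _)
      where
      atAvoid : ∀ s → cofactorTerm M′ (avoidPair a s) ≈ - cofactorTerm M (avoidPair a s)
      atAvoid s = trans (*-congˡ (*-cong (reflexive (P.cong (M zero) (swapAdjacent-avoidPair a s)))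
                          (trans (det-cong (suc m) (λ r t → reflexive (P.cong (M (suc r)) (swapAdjacent-punchIn-avoidPair a s t))))
                                 (det-swapAdjacentColumns m (minor M (avoidPair a s)) (pairIndex a s)))))
                    (trans (*-congˡ (sym (-‿distribʳ-* _ _))) (sym (-‿distribʳ-* _ _)))

  det-equalColumns-zero-suc : ∀ n (M : Matrix S (suc n)) (l : Fin n) →
    (∀ i → M i zero ≈ M i (suc l)) → det S (suc n) M ≈ 0#
  det-equalColumns-zero-suc n M l = byDistance (toℕ l) n M l P.refl
    where
    -- Swapping columns suc l and suc (suc l) brings the equal columns one step closer.
    byDistance : ∀ d n (M : Matrix S (suc n)) (l : Fin n) → toℕ l ≡ d →
                 (∀ i → M i zero ≈ M i (suc l)) → det S (suc n) M ≈ 0#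
    byDistance d       n       M zero    _  eq = det-equalAdjacentColumns n M zero eq
    byDistance zero    n       M (suc l) () eq
    byDistance (suc d) (suc n) M (suc l) e  eq = begin
      det S (suc (suc n)) M    ≈⟨ sym (⁻¹-involutive _) ⟩
      - - det S (suc (suc n)) M ≈⟨ -‿cong (sym (det-swapAdjacentColumns (suc n) M (suc l))) ⟩
      - det S (suc (suc n)) M′  ≈⟨ -‿cong (byDistance d (suc n) M′ (inject₁ l) e′ eq′) ⟩
      - 0#                      ≈⟨ ε⁻¹≈ε ⟩
      0#                        ∎
      where
      M′ : Matrix S (suc (suc n))
      M′ i j = M i (swapAdjacent (suc l) j)
      eq′ : ∀ i → M′ i zero ≈ M′ i (suc (inject₁ l))
      eq′ i rewrite swapAdjacent-inject₁ l = eq i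
      e′ : toℕ (inject₁ l) ≡ d
      e′ = P.trans (toℕ-inject₁ l) (P.cong pred e)

  det-applyColumnOp : ∀ n (o : ColumnOp Carrier n) M → det S (suc n) (applyColumnOp o M) ≈ det S (suc n) M
  det-applyColumnOp n (addToFirst l r) M =
    trans (det-linear (suc n) zero (applyColumnOp (addToFirst l r) M) M L r (λ i → refl) offColM offColL)
          (y≈0⇒x+y≈x (trans (*-congˡ (det-equalColumns-zero-suc n L l (λ i → refl))) (zeroʳ r)))
    where
    L : Matrix S (suc n)
    L i zero    = M i (suc l)
    L i (suc j) = M i (suc j)
    offColM : ∀ i j → j ≢ zero → applyColumnOp (addToFirst l r) M i j ≈ M i j
    offColM i zero    j≢0 = ⊥-elim (j≢0 P.refl)
    offColM i (suc j) j≢0 = refl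
    offColL : ∀ i j → j ≢ zero → applyColumnOp (addToFirst l r) M i j ≈ L i j
    offColL i zero    j≢0 = ⊥-elim (j≢0 P.refl)
    offColL i (suc j) j≢0 = refl
  det-applyColumnOp n (addFirstTo l r) M =
    trans (det-linear (suc n) (suc l) (applyColumnOp (addFirstTo l r) M) M L r onCol offColM offColL)
          (y≈0⇒x+y≈x (trans (*-congˡ (det-equalColumns-zero-suc n L l equalColumns)) (zeroʳ r)))
    where
    L : Matrix S (suc n)
    L i zero    = M i zero
    L i (suc j) = M i (suc j) + δ l j * (M i zero - M i (suc j))
    δll* : ∀ y → δ l l * y ≈ y
    δll* y = trans (*-congʳ (δ-refl l)) (*-identityˡ y)
    δlj* : ∀ {j} → suc j ≢ suc l → ∀ y → δ l j * y ≈ 0#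
    δlj* j≢l y = trans (*-congʳ (δ-≢ (j≢l ∘ P.cong suc ∘ P.sym))) (zeroˡ y)
    onCol : ∀ i → applyColumnOp (addFirstTo l r) M i (suc l) ≈ M i (suc l) + r * L i (suc l)
    onCol i = +-congˡ (trans (δll* _) (*-congˡ (sym (trans (+-congˡ (δll* _)) (x+[y-x]≈y _ _)))))
    offColM : ∀ i j → j ≢ suc l → applyColumnOp (addFirstTo l r) M i j ≈ M i j
    offColM i zero    j≢l = refl
    offColM i (suc j) j≢l = y≈0⇒x+y≈x (δlj* j≢l _)
    offColL : ∀ i j → j ≢ suc l → applyColumnOp (addFirstTo l r) M i j ≈ L i j
    offColL i zero    j≢l = refl
    offColL i (suc j) j≢l = trans (y≈0⇒x+y≈x (δlj* j≢l _)) (sym (y≈0⇒x+y≈x (δlj* j≢l _)))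
    equalColumns : ∀ i → L i zero ≈ L i (suc l)
    equalColumns i = sym (trans (+-congˡ (δll* _)) (x+[y-x]≈y _ _))

  det-applyColumnOps : ∀ n (os : List (ColumnOp Carrier n)) M → det S (suc n) (applyColumnOps os M) ≈ det S (suc n) M
  det-applyColumnOps n []       M = refl
  det-applyColumnOps n (o ∷ os) M = trans (det-applyColumnOps n os (applyColumnOp o M)) (det-applyColumnOp n o M)

  applyColumnOp-inverse : ∀ {n} (o : ColumnOp Carrier n) M i j →
                          applyColumnOp (inverseColumnOp o) (applyColumnOp o M) i j ≈ M i j
  applyColumnOp-inverse (addToFirst l r) M i zero    = trans (+-assoc _ _ _) (y≈0⇒x+y≈x (xy+[-x]y≈0 r _))
  applyColumnOp-inverse (addToFirst l r) M i (suc j) = refl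
  applyColumnOp-inverse (addFirstTo l r) M i zero    = refl
  applyColumnOp-inverse (addFirstTo l r) M i (suc j) =
    trans (+-assoc _ _ _) (y≈0⇒x+y≈x (trans (sym (distribˡ _ _ _)) (trans (*-congˡ (xy+[-x]y≈0 r _)) (zeroʳ _))))

  applyColumnOp-cong : ∀ {n} (o : ColumnOp Carrier n) {M N : Matrix S (suc n)} → (∀ i j → M i j ≈ N i j) →
                       ∀ i j → applyColumnOp o M i j ≈ applyColumnOp o N i j
  applyColumnOp-cong (addToFirst l r) M≈N i zero    = +-cong (M≈N i zero) (*-congˡ (M≈N i (suc l)))
  applyColumnOp-cong (addToFirst l r) M≈N i (suc j) = M≈N i (suc j)
  applyColumnOp-cong (addFirstTo l r) M≈N i zero    = M≈N i zero
  applyColumnOp-cong (addFirstTo l r) M≈N i (suc j) = +-cong (M≈N i (suc j)) (*-congˡ (*-congˡ (M≈N i zero)))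

  det-firstRow-block : ∀ n (M : Matrix S (suc n)) → (∀ j → M zero (suc j) ≈ 0#) →
                       det S (suc n) M ≈ M zero zero * det S n (λ r s → M (suc r) (suc s))
  det-firstRow-block n M firstRow≈0 =
    trans (y≈0⇒x+y≈x (sumF-≈0 n (λ j → trans (*-congˡ (trans (*-congʳ (firstRow≈0 j)) (zeroˡ _))) (zeroʳ _))))
          (*-identityˡ _)

  applyColumnOps-addToFirst : ∀ {n} t (idx : Fin t → Fin n) (y : Fin t → Carrier) (M : Matrix S (suc n)) i →
    let M′ = applyColumnOps (tabulate (λ k → addToFirst (idx k) (y k))) M in
    M′ i zero ≈ M i zero + sumF S t (λ k → y k * M i (suc (idx k)))
  applyColumnOps-addToFirst zero    idx y M i = sym (+-identityʳ _)
  applyColumnOps-addToFirst (suc t) idx y M i =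
    trans (applyColumnOps-addToFirst t (idx ∘ suc) (y ∘ suc) (applyColumnOp (addToFirst (idx zero) (y zero)) M) i)
          (+-assoc _ _ _)

  applyColumnOps-addFirstTo : ∀ {n} t (idx : Fin t → Fin n) (z : Fin t → Carrier) (M : Matrix S (suc n)) i →
    let M′ = applyColumnOps (tabulate (λ k → addFirstTo (idx k) (z k))) M in
    (M′ i zero ≡ M i zero) ×
    (∀ j → M′ i (suc j) ≈ M i (suc j) + sumF S t (λ k → δ (idx k) j * (z k * M i zero)))
  applyColumnOps-addFirstTo zero    idx z M i = P.refl , λ j → sym (+-identityʳ _)
  applyColumnOps-addFirstTo (suc t) idx z M i =
    let corner , rest = applyColumnOps-addFirstTo t (idx ∘ suc) (z ∘ suc) (applyColumnOp (addFirstTo (idx zero) (z zero)) M) i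
    in corner , λ j → trans (rest j) (+-assoc _ _ _)

module Lifting {c ℓ ℓI : Level} (R : CommutativeRing c ℓ) (I : Ideal R ℓI) where
  open CommutativeRing R hiding (zero)
  open Ideal I
  open Quotient R I
  open Determinants R
  private
    module Q = CommutativeRing quotientRing
    module DQ = Determinants quotientRing
  open SetoidReasoning setoid
  open import Algebra.Properties.Ring ring using (-1*x≈-x)
  open import Algebra.Properties.AbelianGroup +-abelianGroup using (⁻¹-∙-comm)
  open import Algebra.Properties.Group +-group using (⁻¹-involutive)
  open import Algebra.Properties.CommutativeSemigroup +-commutativeSemigroup using (x∙yz≈y∙xz)

  Liftable : ∀ {k} → Matrix R k → Set (c ⊔ ℓ ⊔ ℓI)
  Liftable {k} B = ∃ λ (A : SL R k) → ∀ i j → proj₁ A i j ~ B i j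

  det-quotient-cong : ∀ k {M N : Matrix R k} → det R k M ≈ det R k N →
                      det quotientRing k M ~ det quotientRing k N
  det-quotient-cong k {M} {N} e rewrite det-≡ k M | det-≡ k N = lift e

  liftable-applyColumnOp⁻ : ∀ {n} (o : ColumnOp Carrier n) (B : Matrix R (suc n)) →
                            Liftable (applyColumnOp o B) → Liftable B
  liftable-applyColumnOp⁻ {n} o B ((A , detA) , A~oB) =
    (applyColumnOp (inverseColumnOp o) A , trans (det-applyColumnOp n (inverseColumnOp o) A) detA) ,
    λ i j → Q.trans (DQ.applyColumnOp-cong (inverseColumnOp o) A~oB i j) (DQ.applyColumnOp-inverse o B i j)

  liftable-applyColumnOps⁻ : ∀ {n} (os : List (ColumnOp Carrier n)) (B : Matrix R (suc n)) →
                             Liftable (applyColumnOps os B) → Liftable B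
  liftable-applyColumnOps⁻ []       B L = L
  liftable-applyColumnOps⁻ (o ∷ os) B L =
    liftable-applyColumnOp⁻ o B (liftable-applyColumnOps⁻ os (applyColumnOp o B) L)

  det-quotient-applyColumnOps : ∀ {n} (os : List (ColumnOp Carrier n)) (B : Matrix R (suc n)) →
    det quotientRing (suc n) B ~ 1# → det quotientRing (suc n) (applyColumnOps os B) ~ 1#
  det-quotient-applyColumnOps {n} os B detB =
    Q.trans (det-quotient-cong (suc n) {applyColumnOps os B} {B} (det-applyColumnOps n os B)) detB

  IsUnitMod-resp-~ : ∀ {x y} → x ~ y → IsUnitMod x → IsUnitMod y
  IsUnitMod-resp-~ x~y (u , xu~1) = u , Q.trans (Q.*-congʳ (Q.sym x~y)) xu~1

  -- The cofactor expansion of det B writes 1 = det B - (det B - 1) as a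
  -- combination of the first row of B and det B - 1.
  firstRowWithDefect : ∀ {n} → Matrix R (suc n) → Fin (suc (suc n)) → Carrier
  firstRowWithDefect {n} B = B zero zero ◃ (det R (suc n) B - 1#) ◃ (B zero ∘ suc)

  firstRowWithDefect-unital : ∀ n (B : Matrix R (suc n)) → Unital R (firstRowWithDefect B)
  firstRowWithDefect-unital n B = coefficient zero ◃ - 1# ◃ (coefficient ∘ suc) , sym (begin
    coefficient zero * B zero zero + (- 1# * (d - 1#) + sumF R n (λ l → coefficient (suc l) * B zero (suc l)))
      ≈⟨ +-cong (coefficient-* zero) (+-congˡ (sumF-cong n (coefficient-* ∘ suc))) ⟩
    cofactorTerm B zero + (- 1# * (d - 1#) + sumF R n (cofactorTerm B ∘ suc))
      ≈⟨ trans (x∙yz≈y∙xz _ _ _) (+-comm _ _) ⟩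
    d + - 1# * (d - 1#)
      ≈⟨ +-congˡ (trans (-1*x≈-x _) (sym (⁻¹-∙-comm d (- 1#)))) ⟩
    d + (- d + - - 1#)
      ≈⟨ sym (+-assoc _ _ _) ⟩
    (d - d) + - - 1#
      ≈⟨ +-cong (-‿inverseʳ d) (⁻¹-involutive 1#) ⟩
    0# + 1#
      ≈⟨ +-identityˡ 1# ⟩
    1# ∎)
    where
    d : Carrier
    d = det R (suc n) B
    coefficient : Fin (suc n) → Carrier
    coefficient j = signF R j * det R n (minor B j)
    coefficient-* : ∀ j → coefficient j * B zero j ≈ cofactorTerm B j
    coefficient-* j = trans (*-assoc _ _ _) (*-congˡ (*-comm _ _))

  [x+[y+z]]-[x+z]≈y : ∀ x y z → (x + (y + z)) - (x + z) ≈ y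
  [x+[y+z]]-[x+z]≈y x y z = begin
    (x + (y + z)) - (x + z) ≈⟨ +-congʳ (x∙yz≈y∙xz x y z) ⟩
    (y + (x + z)) - (x + z) ≈⟨ +-assoc _ _ _ ⟩
    y + ((x + z) - (x + z)) ≈⟨ y≈0⇒x+y≈x (-‿inverseʳ _) ⟩
    y                       ∎

  cornerUnit : USC R I → ∀ n (B : Matrix R (suc n)) → det quotientRing (suc n) B ~ 1# →
               ∃ λ (os : List (ColumnOp Carrier n)) → IsUnitMod (applyColumnOps os B zero zero)
  cornerUnit usc n B detB with usc n (firstRowWithDefect B) (firstRowWithDefect-unital n B)
  ... | j , (ρ , j≈ρ·a) , unit =
    tabulate (λ l → addToFirst l (ρ (suc l))) ,
    IsUnitMod-resp-~ (Q.trans b₀+j~ (lift (sym (applyColumnOps-addToFirst n id (ρ ∘ suc) B zero)))) unit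
    where
    defect∈I : (det R (suc n) B - 1#) ∈I
    defect∈I = P.subst (λ d → (d - 1#) ∈I) (det-≡ (suc n) B) detB
    b₀+j~ : (B zero zero + j) ~ (B zero zero + sumF R n (λ l → ρ (suc l) * B zero (suc l)))
    b₀+j~ = ∈-resp-≈ (sym (trans (+-congʳ (+-congˡ j≈ρ·a)) ([x+[y+z]]-[x+z]≈y _ _ _))) (*-closed (ρ zero) defect∈I)

  x+[1-x]y~1 : ∀ x {y} → y ~ 1# → (x + (1# - x) * y) ~ 1#
  x+[1-x]y~1 x y~1 = Q.trans (Q.+-congˡ (Q.trans (Q.*-congˡ y~1) (Q.*-identityʳ _))) (DQ.x+[y-x]≈y x 1#)

  -- Columns cannot be rescaled by the inverse of the corner entry, so the
  -- detour through column 1 (first making its top entry 1) is needed.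
  cornerOne : ∀ m (B : Matrix R (suc (suc m))) → IsUnitMod (B zero zero) →
              ∃ λ (os : List (ColumnOp Carrier (suc m))) → applyColumnOps os B zero zero ~ 1#
  cornerOne m B (u , w₀u~1) =
    addFirstTo zero ((1# - w₁) * u) ∷ addToFirst zero (1# - w₀) ∷ [] , x+[1-x]y~1 w₀ top₁~1
    where
    w₀ w₁ : Carrier
    w₀ = B zero zero
    w₁ = B zero (suc zero)
    top₁~1 : (w₁ + 1# * (((1# - w₁) * u) * w₀)) ~ 1#
    top₁~1 = Q.trans (lift (+-congˡ (trans (*-identityˡ _) (trans (*-assoc _ _ _) (*-congˡ (*-comm u w₀))))))
                     (x+[1-x]y~1 w₁ w₀u~1)

  FirstRow~e₀ : ∀ {n} → Matrix R (suc n) → Set ℓI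
  FirstRow~e₀ C = (C zero zero ~ 1#) × (∀ j → C zero (suc j) ~ 0#)

  clearFirstRow : ∀ n (C : Matrix R (suc n)) → C zero zero ~ 1# →
                  FirstRow~e₀ (applyColumnOps (tabulate (λ k → addFirstTo k (- C zero (suc k)))) C)
  clearFirstRow n C corner~1 = P.subst (_~ 1#) (P.sym (proj₁ cleared)) corner~1 , rest~0
    where
    C′ : Matrix R (suc n)
    C′ = applyColumnOps (tabulate (λ k → addFirstTo k (- C zero (suc k)))) C
    cleared : (C′ zero zero ≡ C zero zero) ×
              (∀ j → C′ zero (suc j) ≈ C zero (suc j) + sumF R n (λ k → δ k j * (- C zero (suc k) * C zero zero)))
    cleared = applyColumnOps-addFirstTo n id (λ k → - C zero (suc k)) C zero
    rest~0 : ∀ j → C′ zero (suc j) ~ 0#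
    rest~0 j = Q.trans (lift (trans (proj₂ cleared j) (+-congˡ (sumF-δ n j (λ k → - C zero (suc k) * C zero zero)))))
                       (Q.trans (Q.+-congˡ (Q.*-congˡ corner~1))
                                (lift (trans (+-congˡ (*-identityʳ _)) (-‿inverseʳ _))))

  reduceFirstRow : USC R I → ∀ m (B : Matrix R (suc (suc m))) → det quotientRing (suc (suc m)) B ~ 1# →
                   ∃ λ (os : List (ColumnOp Carrier (suc m))) → FirstRow~e₀ (applyColumnOps os B)
  reduceFirstRow usc m B detB =
    proj₁ reachUnit ++ proj₁ reachOne ++ clearing ,
    P.subst FirstRow~e₀ composite (clearFirstRow (suc m) B₂ (proj₂ reachOne))
    where
    reachUnit : ∃ λ (os : List (ColumnOp Carrier (suc m))) → IsUnitMod (applyColumnOps os B zero zero)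
    reachUnit = cornerUnit usc (suc m) B detB
    B₁ B₂ : Matrix R (suc (suc m))
    B₁ = applyColumnOps (proj₁ reachUnit) B
    reachOne : ∃ λ (os : List (ColumnOp Carrier (suc m))) → applyColumnOps os B₁ zero zero ~ 1#
    reachOne = cornerOne m B₁ (proj₂ reachUnit)
    B₂ = applyColumnOps (proj₁ reachOne) B₁
    clearing : List (ColumnOp Carrier (suc m))
    clearing = tabulate (λ k → addFirstTo k (- B₂ zero (suc k)))
    composite : applyColumnOps clearing B₂ ≡ applyColumnOps (proj₁ reachUnit ++ proj₁ reachOne ++ clearing) B
    composite = P.sym (P.trans (applyColumnOps-++ (proj₁ reachUnit) (proj₁ reachOne ++ clearing) B)
                               (applyColumnOps-++ (proj₁ reachOne) clearing B₁))

  liftable-firstRow~e₀ : ∀ n (C : Matrix R (suc n)) → FirstRow~e₀ C → det quotientRing (suc n) C ~ 1# →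
    (∀ (N : Matrix R n) → det quotientRing n N ~ 1# → Liftable N) → Liftable C
  liftable-firstRow~e₀ n C (corner~1 , rest~0) detC liftMinor =
    (A , trans (det-firstRow-block n A (λ _ → refl)) (trans (*-identityˡ _) (proj₂ (proj₁ liftN)))) , A~C
    where
    N : Matrix R n
    N r s = C (suc r) (suc s)
    detN : det quotientRing n N ~ 1#
    detN = Q.trans (Q.sym (Q.*-identityˡ _))
             (Q.trans (Q.*-congʳ (Q.sym corner~1)) (Q.trans (Q.sym (DQ.det-firstRow-block n C rest~0)) detC))
    liftN : Liftable N
    liftN = liftMinor N detN
    A′ : Matrix R n
    A′ = proj₁ (proj₁ liftN)
    A : Matrix R (suc n)
    A zero    zero    = 1#
    A zero    (suc s) = 0#
    A (suc r) zero    = C (suc r) zero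
    A (suc r) (suc s) = A′ r s
    A~C : ∀ i j → A i j ~ C i j
    A~C zero    zero    = Q.sym corner~1
    A~C zero    (suc s) = Q.sym (rest~0 s)
    A~C (suc r) zero    = Q.refl
    A~C (suc r) (suc s) = proj₂ liftN r s

  liftable : USC R I → ∀ k (B : Matrix R k) → det quotientRing k B ~ 1# → Liftable B
  liftable usc zero          B detB = (B , refl) , λ ()
  liftable usc (suc zero)    B detB = liftable-firstRow~e₀ zero B (corner~1 , λ ()) detB (liftable usc zero)
    where
    corner~1 : B zero zero ~ 1#
    corner~1 = Q.trans (Q.sym (Q.*-identityʳ _)) (Q.trans (Q.sym (DQ.det-firstRow-block zero B (λ ()))) detB)
  liftable usc (suc (suc m)) B detB =
    liftable-applyColumnOps⁻ os B
      (liftable-firstRow~e₀ (suc m) (applyColumnOps os B) (proj₂ reduced) (det-quotient-applyColumnOps os B detB)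
                            (liftable usc (suc m)))
    where
    reduced : ∃ λ (os : List (ColumnOp Carrier (suc m))) → FirstRow~e₀ (applyColumnOps os B)
    reduced = reduceFirstRow usc m B detB
    os : List (ColumnOp Carrier (suc m))
    os = proj₁ reduced

mainTheorem2 : {c ℓ ℓI : Level} (R : CommutativeRing c ℓ) (I : Ideal R ℓI) →
    USC R I → (k : ℕ) → 1 ≤ k →
    (B : SL (Quotient.quotientRing R I) k) →
    ∃ λ (A : SL R k) → Quotient._≈SL_ R I (Quotient.reduce R I k A) B
mainTheorem2 R I usc k _ (B , detB) = Lifting.liftable R I usc k B detB
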